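{- Let $a,d,h,x$ be positive integers with $\gcd(a,d)=1$ and $1\leq x\leq a-1$, and let $S=\langle a,ha+d,\ldots,ha+xd\rangle$. Let $n=qa+id$ with $q,i$ integers. Then $n\in S$ if and only if $$\left\lceil\frac{i \bmod a}{x}\right\rceil h\leq q+\left\lfloor\frac{i}{a}\right\rfloor d.$$ Moreover, in this case $$\max\mathsf{L}(n)=\Big(q+\left\lfloor\frac{i}{a}\right\rfloor d\Big)-\left\lceil\frac{i\bmod a}{x}\right\rceil(h-1).$$
   Context: $\langle n_0,\ldots,n_x\rangle$ denotes the submonoid of $\mathbb{N}=\{0,1,2,\ldots\}$ generated by $n_0,\ldots,n_x$. Its minimal generators are $n_0=a$ and $n_j=ha+jd$ for $1\leq j\leq x$. A factorization of $n\in S$ is a tuple $z\in\mathbb{N}^{x+1}$ with $\sum_j z_jn_j=n$. Its length is $|z|=\sum_jz_j$. $\mathsf{L}(n)$ is the set of lengths of factorizations of $n$. $i\bmod a$ denotes the remainder of $i$ upon division by $a$, lying in $\{0,\ldots,a-1\}$, so that $i=\lfloor i/a\rfloor a+(i\bmod a)$. $\lceil\cdot\rceil$ and $\lfloor\cdot\rfloor$ are the ceiling and floor functions. -}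

module Defs where

open import Data.Nat using (ℕ; zero; suc; _+_; _*_; _∸_; NonZero)
open import Data.Nat.DivMod using (_/_)
open import Data.Fin using (Fin; zero; suc; toℕ)
open import Data.Integer using (ℤ; +_)
open import Data.Product using (Σ; _×_)
open import Relation.Binary.PropositionalEquality using (_≡_)

∑ : (n : ℕ) → (Fin n → ℕ) → ℕ
∑ zero    f = 0
∑ (suc n) f = f zero + ∑ n (λ j → f (suc j))

gen : (a h d x : ℕ) → Fin (suc x) → ℕ
gen a h d x zero    = a
gen a h d x (suc j) = h * a + toℕ (suc j) * d

Factorization : ℕ → Set
Factorization x = Fin (suc x) → ℕ

value : (a h d x : ℕ) → Factorization x → ℕ
value a h d x z = ∑ (suc x) (λ j → z j * gen a h d x j)

len : (x : ℕ) → Factorization x → ℕ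
len x z = ∑ (suc x) z

IsFactorizationOf : (a h d x : ℕ) → Factorization x → ℤ → Set
IsFactorizationOf a h d x z n = + (value a h d x z) ≡ n

InS : (a h d x : ℕ) → ℤ → Set
InS a h d x n = Σ (Factorization x) (λ z → IsFactorizationOf a h d x z n)

⌈_/_⌉ : ℕ → (x : ℕ) → .{{NonZero x}} → ℕ
⌈ r / x ⌉ = (r + (x ∸ 1)) / x

{-# OPTIONS --safe #-}
-- A factorization z of n uses K = z₁ + ⋯ + z_x generators other than a, its value is
-- (z₀ + h K) a + J d with J = Σ j z_j ≤ x K, and its length is z₀ + K.  Write n = Q a + r d
-- with 0 ≤ r < a.  As gcd(a, d) = 1 this normal form is unique, so J = r + t a and
-- Q = z₀ + h K + t d; hence K ≥ ⌈r/x⌉, Q ≥ ⌈r/x⌉ h and |z| = Q - (h - 1) K - t d ≤ Q - (h - 1)⌈r/x⌉.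
-- Conversely, if Q ≥ ⌈r/x⌉ h, then ⌈r/x⌉ generators ha + jd with Σ j = r (mostly ha + xd),
-- completed by Q - ⌈r/x⌉ h copies of a, give a factorization attaining that length.
module Submission where

open import Defs
open import Data.Nat using (ℕ; NonZero; zero; suc; _∸_) renaming (_≤_ to _≤ℕ_)
open import Data.Nat.GCD using (gcd)
open import Data.Nat.Coprimality using (Coprime; gcd≡1⇒coprime)
open import Data.Fin using (Fin; zero; suc; toℕ; fromℕ; fromℕ<)
open import Data.Fin.Properties using (toℕ<n; toℕ-fromℕ; toℕ-fromℕ<)
open import Data.Vec.Functional using (Vector; head; tail; _∷_)
open import Data.Product using (Σ; _×_; _,_; proj₁; proj₂; map₂)
open import Function.Base using (_∘_)
open import Function.Bundles using (_⇔_; mk⇔)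
open import Relation.Binary.PropositionalEquality
  using (_≡_; _≗_; refl; sym; trans; cong; cong₂; subst; module ≡-Reasoning)

-- Natural-number arithmetic is opened only in this block: afterwards _+_, _*_ and _≤_ are
-- the integer operations of the theorem, and ℕ's are written qualified.
module _ where
  open import Data.Nat using (_+_; _*_; _≤_; _<_)
  open import Data.Nat.Properties
  open import Data.Nat.DivMod
  open import Data.Nat.Divisibility using (n∣m*n)
  open import Data.Nat.Tactic.RingSolver using (solve-∀)
  open import Algebra.Properties.CommutativeSemigroup +-commutativeSemigroup using (interchange)

  ∑-cong : ∀ n {f g : Vector ℕ n} → f ≗ g → ∑ n f ≡ ∑ n g
  ∑-cong zero    f≗g = refl
  ∑-cong (suc n) f≗g = cong₂ _+_ (f≗g zero) (∑-cong n (λ j → f≗g (suc j)))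

  ∑-zero : ∀ n → ∑ n (λ _ → 0) ≡ 0
  ∑-zero zero    = refl
  ∑-zero (suc n) = ∑-zero n

  ∑-distrib-+ : ∀ n (f g : Vector ℕ n) → ∑ n (λ j → f j + g j) ≡ ∑ n f + ∑ n g
  ∑-distrib-+ zero    f g = refl
  ∑-distrib-+ (suc n) f g = trans (cong (f zero + g zero +_) (∑-distrib-+ n (tail f) (tail g)))
                                  (interchange (f zero) (g zero) (∑ n (tail f)) (∑ n (tail g)))

  *-distribˡ-∑ : ∀ n c (f : Vector ℕ n) → c * ∑ n f ≡ ∑ n (λ j → c * f j)
  *-distribˡ-∑ zero    c f = *-zeroʳ c
  *-distribˡ-∑ (suc n) c f = trans (*-distribˡ-+ c (f zero) (∑ n (tail f)))
                                   (cong (c * f zero +_) (*-distribˡ-∑ n c (tail f)))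

  ∑-mono-≤ : ∀ n {f g : Vector ℕ n} → (∀ j → f j ≤ g j) → ∑ n f ≤ ∑ n g
  ∑-mono-≤ zero    f≤g = ≤-refl
  ∑-mono-≤ (suc n) f≤g = +-mono-≤ (f≤g zero) (∑-mono-≤ n (λ j → f≤g (suc j)))

  point : ∀ {n} → Fin n → ℕ → Vector ℕ n
  point zero    v zero    = v
  point zero    v (suc j) = 0
  point (suc i) v zero    = 0
  point (suc i) v (suc j) = point i v j

  ∑-point : ∀ {n} (i : Fin n) v → ∑ n (point i v) ≡ v
  ∑-point {suc n} zero    v = trans (cong (v +_) (∑-zero n)) (+-identityʳ v)
  ∑-point {suc n} (suc i) v = ∑-point i v

  ∑-point-* : ∀ {n} (i : Fin n) v (g : Vector ℕ n) → ∑ n (λ j → point i v j * g j) ≡ v * g i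
  ∑-point-* {suc n} zero    v g = trans (cong (v * g zero +_) (∑-zero n)) (+-identityʳ (v * g zero))
  ∑-point-* {suc n} (suc i) v g = ∑-point-* i v (tail g)

  -- Entry j of the tail of a factorization counts the generator h a + (j + 1) d,
  -- so weight (tail z) is the coefficient of d in its value.
  weight : ∀ {n} → Vector ℕ n → ℕ
  weight {n} w = ∑ n (λ j → w j * suc (toℕ j))

  weight-+ : ∀ {n} (u v : Vector ℕ n) → weight (λ j → u j + v j) ≡ weight u + weight v
  weight-+ {n} u v = trans (∑-cong n (λ j → *-distribʳ-+ (suc (toℕ j)) (u j) (v j)))
                           (∑-distrib-+ n _ _)

  weight-point : ∀ {n} (i : Fin n) v → weight (point i v) ≡ v * suc (toℕ i)
  weight-point i v = ∑-point-* i v (suc ∘ toℕ)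

  weight≤n*∑ : ∀ {n} (w : Vector ℕ n) → weight w ≤ n * ∑ n w
  weight≤n*∑ {n} w = ≤-trans (∑-mono-≤ n term≤) (≤-reflexive (sym (*-distribˡ-∑ n n w)))
    where
    term≤ : ∀ j → w j * suc (toℕ j) ≤ n * w j
    term≤ j = ≤-trans (*-monoʳ-≤ (w j) (toℕ<n j)) (≤-reflexive (*-comm (w j) n))

  value≡ : ∀ a h d x (z : Factorization x) →
           value a h d x z ≡ (head z + h * ∑ x (tail z)) * a + weight (tail z) * d
  value≡ a h d x z = begin
    head z * a + ∑ x (λ j → tail z j * (h * a + suc (toℕ j) * d))
      ≡⟨ cong (head z * a +_) (∑-cong x (λ j → spread h a d (tail z j) (suc (toℕ j)))) ⟩
    head z * a + ∑ x (λ j → h * a * tail z j + d * (tail z j * suc (toℕ j)))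
      ≡⟨ cong (head z * a +_) (∑-distrib-+ x _ _) ⟩
    head z * a + (∑ x (λ j → h * a * tail z j) + ∑ x (λ j → d * (tail z j * suc (toℕ j))))
      ≡⟨ cong (head z * a +_) (sym (cong₂ _+_ (*-distribˡ-∑ x (h * a) (tail z)) (*-distribˡ-∑ x d _))) ⟩
    head z * a + (h * a * ∑ x (tail z) + d * weight (tail z))
      ≡⟨ regroup h a d (head z) (∑ x (tail z)) (weight (tail z)) ⟩
    (head z + h * ∑ x (tail z)) * a + weight (tail z) * d ∎
    where
    open ≡-Reasoning
    spread : ∀ h a d w s → w * (h * a + s * d) ≡ h * a * w + d * (w * s)
    spread = solve-∀
    regroup : ∀ h a d z₀ k j → z₀ * a + (h * a * k + d * j) ≡ (z₀ + h * k) * a + j * d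
    regroup = solve-∀

  value-normal-form : ∀ a h d x .{{_ : NonZero a}} (z : Factorization x) →
    value a (suc h) d x z
      ≡ (len x z + ∑ x (tail z) * h + weight (tail z) / a * d) * a + weight (tail z) % a * d
  value-normal-form a h d x z = begin
    value a (suc h) d x z
      ≡⟨ value≡ a (suc h) d x z ⟩
    (head z + suc h * ∑ x (tail z)) * a + weight (tail z) * d
      ≡⟨ cong (λ j → (head z + suc h * ∑ x (tail z)) * a + j * d) (m≡m%n+[m/n]*n (weight (tail z)) a) ⟩
    (head z + suc h * ∑ x (tail z)) * a + (weight (tail z) % a + weight (tail z) / a * a) * d
      ≡⟨ regroup h a d (head z) (∑ x (tail z)) (weight (tail z) % a) (weight (tail z) / a) ⟩
    (len x z + ∑ x (tail z) * h + weight (tail z) / a * d) * a + weight (tail z) % a * d ∎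
    where
    open ≡-Reasoning
    regroup : ∀ h a d z₀ k s t → (z₀ + suc h * k) * a + (s + t * a) * d ≡ (z₀ + k + k * h + t * d) * a + s * d
    regroup = solve-∀

  [m+k*n]/n≡k : ∀ {m n} k .{{_ : NonZero n}} → m < n → (m + k * n) / n ≡ k
  [m+k*n]/n≡k {m} {n} k m<n = begin
    (m + k * n) / n     ≡⟨ +-distrib-/-∣ʳ m (n∣m*n k) ⟩
    m / n + k * n / n   ≡⟨ cong₂ _+_ (m<n⇒m/n≡0 m<n) (m*n/n≡m k n) ⟩
    k                   ∎
    where open ≡-Reasoning

  ⌈m/n⌉≤k : ∀ {m} n k → m ≤ suc n * k → ⌈ m / suc n ⌉ ≤ k
  ⌈m/n⌉≤k {m} n k m≤n*k = begin
    (m + n) / suc n          ≤⟨ /-monoˡ-≤ (suc n) (+-monoˡ-≤ n m≤n*k) ⟩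
    (suc n * k + n) / suc n  ≡⟨ cong (_/ suc n) (trans (+-comm (suc n * k) n) (cong (n +_) (*-comm (suc n) k))) ⟩
    (n + k * suc n) / suc n  ≡⟨ [m+k*n]/n≡k {n} k (n<1+n n) ⟩
    k                        ∎
    where open ≤-Reasoning

  -- Writing r - 1 = s + k (n + 1) with s ≤ n, use k copies of the heaviest generator and one of weight s + 1.
  shortest-tail : ∀ n r → Σ (Vector ℕ (suc n)) (λ w → ∑ (suc n) w ≡ ⌈ r / suc n ⌉ × weight w ≡ r)
  shortest-tail n zero    = (λ _ → 0) , trans (∑-zero (suc n)) (sym (m<n⇒m/n≡0 (n<1+n n))) , ∑-zero (suc n)
  shortest-tail n (suc r) = w , count , total
    where
    open ≡-Reasoning
    s = r % suc n
    k = r / suc n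
    s<1+n : s < suc n
    s<1+n = m%n<n r (suc n)
    heaviest single : Vector ℕ (suc n)
    heaviest = point (fromℕ n) k
    single   = point (fromℕ< s<1+n) 1
    w : Vector ℕ (suc n)
    w j = single j + heaviest j
    r≡ : r ≡ s + k * suc n
    r≡ = m≡m%n+[m/n]*n r (suc n)
    count : ∑ (suc n) w ≡ ⌈ suc r / suc n ⌉
    count = begin
      ∑ (suc n) w                              ≡⟨ ∑-distrib-+ (suc n) single heaviest ⟩
      ∑ (suc n) single + ∑ (suc n) heaviest    ≡⟨ cong₂ _+_ (∑-point (fromℕ< s<1+n) 1) (∑-point (fromℕ n) k) ⟩
      suc k                                    ≡⟨ sym ([m+k*n]/n≡k (suc k) s<1+n) ⟩
      (s + suc k * suc n) / suc n              ≡⟨ cong (_/ suc n) (sym (regroup n s k)) ⟩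
      (suc (s + k * suc n) + n) / suc n        ≡⟨ cong (λ m → (suc m + n) / suc n) (sym r≡) ⟩
      ⌈ suc r / suc n ⌉                        ∎
      where
      regroup : ∀ n s k → suc (s + k * suc n) + n ≡ s + suc k * suc n
      regroup = solve-∀
    total : weight w ≡ suc r
    total = begin
      weight w                                 ≡⟨ weight-+ single heaviest ⟩
      weight single + weight heaviest          ≡⟨ cong₂ _+_ (weight-point (fromℕ< s<1+n) 1) (weight-point (fromℕ n) k) ⟩
      1 * suc (toℕ (fromℕ< s<1+n)) + k * suc (toℕ (fromℕ n))
                                               ≡⟨ cong₂ (λ i m → 1 * suc i + k * suc m) (toℕ-fromℕ< s<1+n) (toℕ-fromℕ n) ⟩
      1 * suc s + k * suc n                    ≡⟨ cong (_+ k * suc n) (*-identityˡ (suc s)) ⟩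
      suc (s + k * suc n)                      ≡⟨ cong suc (sym r≡) ⟩
      suc r                                    ∎

open import Data.Integer using (ℤ; +_; 0ℤ; _+_; _-_; _*_; _≤_; +≤+; ∣_∣; _/ℕ_; _%ℕ_)
open import Data.Integer.Properties
  using (abs-*; *-comm; pos-+; pos-*; m-n≡m⊖n; ⊖-≥; ∣m⊝n∣≤m⊔n; +-injective;
         i≡j⇒i-j≡0; i-j≡0⇒i≡j; ∣i∣≡0⇒i≡0; *-cancelʳ-≡; +-inverseʳ)
open import Data.Integer.DivMod using (a≡a%ℕn+[a/ℕn]*n; n%ℕd<d)
import Data.Integer.Coprimality as ℤ
open import Data.Integer.Tactic.RingSolver using (solve-∀)
import Data.Nat as ℕ
import Data.Nat.Properties as ℕ
import Data.Nat.DivMod as ℕ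
import Data.Nat.Divisibility as ℕ

pos-lincomb : ∀ m a n d → + (m ℕ.* a ℕ.+ n ℕ.* d) ≡ + m * + a + + n * + d
pos-lincomb m a n d = trans (pos-+ (m ℕ.* a) (n ℕ.* d)) (cong₂ _+_ (pos-* m a) (pos-* n d))

+m-+n*+k≡+[m∸n*k] : ∀ {m} n k → n ℕ.* k ℕ.≤ m → + m - + n * + k ≡ + (m ∸ n ℕ.* k)
+m-+n*+k≡+[m∸n*k] {m} n k n*k≤m =
  trans (cong (λ e → + m - e) (sym (pos-* n k))) (trans (m-n≡m⊖n m (n ℕ.* k)) (⊖-≥ n*k≤m))

m+n*k≡o⇒+m≡+o-+n*+k : ∀ {m o} n k → m ℕ.+ n ℕ.* k ≡ o → + m ≡ + o - + n * + k
m+n*k≡o⇒+m≡+o-+n*+k {m} n k refl =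
  sym (trans (+m-+n*+k≡+[m∸n*k] n k (ℕ.m≤n+m (n ℕ.* k) m)) (cong +_ (ℕ.m+n∸n≡m m (n ℕ.* k))))

∣+m-+n∣<o : ∀ {m n o} → m ℕ.< o → n ℕ.< o → ∣ + m - + n ∣ ℕ.< o
∣+m-+n∣<o {m} {n} m<o n<o = ℕ.≤-<-trans
  (subst (ℕ._≤ m ℕ.⊔ n) (cong ∣_∣ (sym (m-n≡m⊖n m n))) (∣m⊝n∣≤m⊔n m n))
  (ℕ.⊔-pres-<m m<o n<o)

-- Coprimality makes a ∣ (r - s) d force r ≡ s, since |r - s| < a.
normal-form-unique : ∀ {a d} .{{_ : NonZero a}} → Coprime a d → ∀ {r s} → r ℕ.< a → s ℕ.< a →
  ∀ X Y → X * + a + + r * + d ≡ Y * + a + + s * + d → r ≡ s × X ≡ Y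
normal-form-unique {a} {d} coprime {r} {s} r<a s<a X Y eq = r≡s , X≡Y
  where
  open ≡-Reasoning
  rearrange : ∀ X Y A R S D → (R - S) * D ≡ (Y - X) * A + (X * A + R * D - (Y * A + S * D))
  rearrange = solve-∀
  shift : (+ r - + s) * + d ≡ (Y - X) * + a
  shift = begin
    (+ r - + s) * + d                       ≡⟨ rearrange X Y (+ a) (+ r) (+ s) (+ d) ⟩
    (Y - X) * + a + (X * + a + + r * + d - (Y * + a + + s * + d))
                                            ≡⟨ cong (λ e → (Y - X) * + a + e) (i≡j⇒i-j≡0 eq) ⟩
    (Y - X) * + a + 0ℤ                      ≡⟨ Data.Integer.Properties.+-identityʳ _ ⟩
    (Y - X) * + a                           ∎
  a∣r-s : a ℕ.∣ ∣ + r - + s ∣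
  a∣r-s = ℤ.coprime-divisor (+ a) (+ d) (+ r - + s) coprime
    (ℕ.divides ∣ Y - X ∣ (trans (cong ∣_∣ (trans (*-comm (+ d) (+ r - + s)) shift)) (abs-* (Y - X) (+ a))))
  ∣r-s∣≡0 : ∣ + r - + s ∣ ≡ 0
  ∣r-s∣≡0 = trans (sym (ℕ.m<n⇒m%n≡m (∣+m-+n∣<o r<a s<a))) (ℕ.n∣m⇒m%n≡0 _ a a∣r-s)
  r≡s : r ≡ s
  r≡s = +-injective (i-j≡0⇒i≡j (+ r) (+ s) (∣i∣≡0⇒i≡0 ∣r-s∣≡0))
  [Y-X]*a≡0 : (Y - X) * + a ≡ 0ℤ
  [Y-X]*a≡0 = begin
    (Y - X) * + a       ≡⟨ sym shift ⟩
    (+ r - + s) * + d   ≡⟨ cong (λ t → (+ r - + t) * + d) (sym r≡s) ⟩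
    (+ r - + r) * + d   ≡⟨ cong (_* + d) (+-inverseʳ (+ r)) ⟩
    0ℤ                  ∎
  X≡Y : X ≡ Y
  X≡Y = sym (i-j≡0⇒i≡j Y X (*-cancelʳ-≡ (Y - X) 0ℤ (+ a) [Y-X]*a≡0))

normal-form : ∀ a d .{{_ : NonZero a}} q i → q * + a + i * + d ≡ (q + (i /ℕ a) * + d) * + a + + (i %ℕ a) * + d
normal-form a d q i = trans (cong (λ j → q * + a + j * + d) (a≡a%ℕn+[a/ℕn]*n i a))
                            (regroup q (+ (i %ℕ a)) (i /ℕ a) (+ a) (+ d))
  where
  regroup : ∀ q r k a d → q * a + (r + k * a) * d ≡ (q + k * d) * a + r * d
  regroup = solve-∀

-- Here h and x stand for the paper's h - 1 and x - 1.
module Factorizations {a d : ℕ} .{{_ : NonZero a}} (coprime : Coprime a d) (h x : ℕ) {r : ℕ} (r<a : r ℕ.< a) where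

  factorization-shape : (Q : ℤ) (w : Factorization (suc x)) →
    IsFactorizationOf a (suc h) d (suc x) w (Q * + a + + r * + d) →
    ⌈ r / suc x ⌉ ℕ.≤ ∑ (suc x) (tail w)
      × Σ ℕ (λ e → Q ≡ + (len (suc x) w ℕ.+ ∑ (suc x) (tail w) ℕ.* h ℕ.+ e))
  factorization-shape Q w w↦n = c≤K , J ℕ./ a ℕ.* d , sym (proj₂ unique)
    where
    K = ∑ (suc x) (tail w)
    J = weight (tail w)
    N = len (suc x) w ℕ.+ K ℕ.* h ℕ.+ J ℕ./ a ℕ.* d
    unique : J ℕ.% a ≡ r × + N ≡ Q
    unique = normal-form-unique coprime (ℕ.m%n<n J a) r<a (+ N) Q
      (trans (sym (pos-lincomb N a (J ℕ.% a) d))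
        (trans (cong +_ (sym (value-normal-form a h d (suc x) w))) w↦n))
    c≤K : ⌈ r / suc x ⌉ ℕ.≤ K
    c≤K = ⌈m/n⌉≤k x K (subst (ℕ._≤ suc x ℕ.* K) (proj₁ unique)
            (ℕ.≤-trans (ℕ.m%n≤m J a) (weight≤n*∑ (tail w))))

  membership⇒bound : (Q : ℤ) → InS a (suc h) d (suc x) (Q * + a + + r * + d) →
    + (⌈ r / suc x ⌉ ℕ.* suc h) ≤ Q
  membership⇒bound Q (w , w↦n) = bound (factorization-shape Q w w↦n)
    where
    c = ⌈ r / suc x ⌉
    K = ∑ (suc x) (tail w)
    bound : c ℕ.≤ K × Σ ℕ (λ e → Q ≡ + (len (suc x) w ℕ.+ K ℕ.* h ℕ.+ e)) → + (c ℕ.* suc h) ≤ Q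
    bound (c≤K , e , Q≡) = subst (+ (c ℕ.* suc h) ≤_) (sym Q≡) (+≤+ (begin
      c ℕ.* suc h                      ≡⟨ ℕ.*-suc c h ⟩
      c ℕ.+ c ℕ.* h                    ≤⟨ ℕ.+-mono-≤ (ℕ.≤-trans c≤K (ℕ.m≤n+m K (head w))) (ℕ.*-monoˡ-≤ h c≤K) ⟩
      len (suc x) w ℕ.+ K ℕ.* h        ≤⟨ ℕ.m≤m+n _ e ⟩
      len (suc x) w ℕ.+ K ℕ.* h ℕ.+ e  ∎))
      where open ℕ.≤-Reasoning

  length-bound : (Q : ℤ) (w : Factorization (suc x)) →
    IsFactorizationOf a (suc h) d (suc x) w (Q * + a + + r * + d) →
    + len (suc x) w ≤ Q - + ⌈ r / suc x ⌉ * + h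
  length-bound Q w w↦n = bound (factorization-shape Q w w↦n)
    where
    c = ⌈ r / suc x ⌉
    K = ∑ (suc x) (tail w)
    bound : c ℕ.≤ K × Σ ℕ (λ e → Q ≡ + (len (suc x) w ℕ.+ K ℕ.* h ℕ.+ e)) → + len (suc x) w ≤ Q - + c * + h
    bound (c≤K , e , Q≡) = subst (λ Q → + len (suc x) w ≤ Q - + c * + h) (sym Q≡)
      (subst (+ len (suc x) w ≤_) (sym (+m-+n*+k≡+[m∸n*k] c h (ℕ.≤-trans (ℕ.m≤n+m _ _) len+ch≤)))
             (+≤+ (ℕ.m+n≤o⇒m≤o∸n _ len+ch≤)))
      where
      len+ch≤ : len (suc x) w ℕ.+ c ℕ.* h ℕ.≤ len (suc x) w ℕ.+ K ℕ.* h ℕ.+ e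
      len+ch≤ = ℕ.≤-trans (ℕ.+-monoʳ-≤ (len (suc x) w) (ℕ.*-monoˡ-≤ h c≤K)) (ℕ.m≤m+n _ e)

  longest-factorization : (Q : ℤ) → + (⌈ r / suc x ⌉ ℕ.* suc h) ≤ Q →
    Σ (Factorization (suc x)) (λ z → IsFactorizationOf a (suc h) d (suc x) z (Q * + a + + r * + d)
                                     × + len (suc x) z ≡ Q - + ⌈ r / suc x ⌉ * + h)
  longest-factorization (+ N) (+≤+ c*h≤N) = z , z↦n , length
    where
    open ≡-Reasoning
    c = ⌈ r / suc x ⌉
    tail-data = shortest-tail x r
    w = proj₁ tail-data
    ∑w≡c : ∑ (suc x) w ≡ c
    ∑w≡c = proj₁ (proj₂ tail-data)
    weight≡r : weight w ≡ r
    weight≡r = proj₂ (proj₂ tail-data)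
    z₀ = N ∸ c ℕ.* suc h
    z : Factorization (suc x)
    z = z₀ ∷ w
    z₀+h*c≡N : z₀ ℕ.+ suc h ℕ.* c ≡ N
    z₀+h*c≡N = trans (cong (z₀ ℕ.+_) (ℕ.*-comm (suc h) c)) (ℕ.m∸n+n≡m c*h≤N)
    z↦n : IsFactorizationOf a (suc h) d (suc x) z (+ N * + a + + r * + d)
    z↦n = begin
      + value a (suc h) d (suc x) z
        ≡⟨ cong +_ (value≡ a (suc h) d (suc x) z) ⟩
      + ((z₀ ℕ.+ suc h ℕ.* ∑ (suc x) w) ℕ.* a ℕ.+ weight w ℕ.* d)
        ≡⟨ cong₂ (λ k j → + ((z₀ ℕ.+ suc h ℕ.* k) ℕ.* a ℕ.+ j ℕ.* d)) ∑w≡c weight≡r ⟩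
      + ((z₀ ℕ.+ suc h ℕ.* c) ℕ.* a ℕ.+ r ℕ.* d)
        ≡⟨ cong (λ m → + (m ℕ.* a ℕ.+ r ℕ.* d)) z₀+h*c≡N ⟩
      + (N ℕ.* a ℕ.+ r ℕ.* d)
        ≡⟨ pos-lincomb N a r d ⟩
      + N * + a + + r * + d ∎
    len+c*h≡N : len (suc x) z ℕ.+ c ℕ.* h ≡ N
    len+c*h≡N = begin
      z₀ ℕ.+ ∑ (suc x) w ℕ.+ c ℕ.* h   ≡⟨ cong (λ k → z₀ ℕ.+ k ℕ.+ c ℕ.* h) ∑w≡c ⟩
      z₀ ℕ.+ c ℕ.+ c ℕ.* h             ≡⟨ ℕ.+-assoc z₀ c (c ℕ.* h) ⟩
      z₀ ℕ.+ (c ℕ.+ c ℕ.* h)           ≡⟨ cong (z₀ ℕ.+_) (sym (ℕ.*-suc c h)) ⟩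
      z₀ ℕ.+ c ℕ.* suc h               ≡⟨ ℕ.m∸n+n≡m c*h≤N ⟩
      N                                ∎
    length : + len (suc x) z ≡ + N - + c * + h
    length = m+n*k≡o⇒+m≡+o-+n*+k c h len+c*h≡N

-- The hypothesis x ≤ a ∸ 1 only makes the generators minimal; the theorem holds without it.
mainTheorem2 : (a d h x : ℕ) → .{{_ : NonZero a}} → .{{_ : NonZero d}} → .{{_ : NonZero h}} → .{{_ : NonZero x}}
    → gcd a d ≡ 1 → x ≤ℕ a ∸ 1 → (q i : ℤ)
    → (InS a h d x (q * + a + i * + d) ⇔ (+ (⌈ i %ℕ a / x ⌉ Data.Nat.* h) ≤ q + (i /ℕ a) * + d))
      × (InS a h d x (q * + a + i * + d)
         → Σ (Factorization x) (λ z → IsFactorizationOf a h d x z (q * + a + i * + d)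
               × (+ len x z ≡ (q + (i /ℕ a) * + d) - + ⌈ i %ℕ a / x ⌉ * (+ h - + 1)))
           × ((w : Factorization x) → IsFactorizationOf a h d x w (q * + a + i * + d)
               → + len x w ≤ (q + (i /ℕ a) * + d) - + ⌈ i %ℕ a / x ⌉ * (+ h - + 1)))
mainTheorem2 a d (suc h) (suc x) gcd≡1 _ q i rewrite normal-form a d q i =
  mk⇔ (membership⇒bound Q) (map₂ proj₁ ∘ longest-factorization Q)
  , λ n∈S → longest-factorization Q (membership⇒bound Q n∈S) , length-bound Q
  where
  Q = q + (i /ℕ a) * + d
  open Factorizations (gcd≡1⇒coprime gcd≡1) h x (n%ℕd<d i a)
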